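{- The set of permutations $\sigma$ such that $S(B(\sigma))$ is increasing is the pattern class $\mathrm{Av}(3241,2341,4231,2431)$.
   Context: Permutations are sequences of length $n\ge1$ using each of $1,\ldots,n$ once. For any finite sequence of distinct numbers, the bubble sort pass $B$ is defined recursively by $B(\epsilon)=\epsilon$ and, writing a non-empty sequence as $\sigma=\sigma_1 m\sigma_2$ with $m$ its largest term, $B(\sigma)=B(\sigma_1)\sigma_2 m$. West's stack sorting operator $S$ is defined by $S(\epsilon)=\epsilon$ and $S(\alpha m\beta)=S(\alpha)S(\beta)m$ where $m$ is the largest term. $\mathrm{Av}(M)$ is the set of permutations having no (not necessarily consecutive) subsequence order isomorphic to any element of $M$. -}

module Defs where

open import Data.Nat using (ℕ; zero; suc; _<_; _≤_; _⊔_; _≟_)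
open import Data.List using (List; []; _∷_; _++_; [_]; length; map; upTo; foldr; lookup)
open import Data.List.Membership.Propositional using (_∈_)
open import Data.List.Relation.Binary.Permutation.Propositional using (_↭_)
open import Data.List.Relation.Binary.Sublist.Propositional using (_⊆_)
open import Data.Product using (_×_; _,_; Σ; ∃; ∃-syntax; map₁)
open import Data.Fin using (Fin; cast)
open import Function.Bundles using (_⇔_)
open import Relation.Nullary using (¬_; yes; no)
open import Relation.Binary.PropositionalEquality using (_≡_)

IsPerm : List ℕ → Set
IsPerm σ = (1 ≤ length σ) × (σ ↭ map suc (upTo (length σ)))

-- largest term of a list (0 for the empty list; only used on non-empty lists
-- of positive numbers)
maxOf : List ℕ → ℕ
maxOf = foldr _⊔_ 0

cut : ℕ → List ℕ → List ℕ × List ℕ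
cut m [] = [] , []
cut m (x ∷ xs) with x ≟ m
... | yes _ = [] , xs
... | no _  = map₁ (x ∷_) (cut m xs)

-- Bubble sort pass with fuel: B(σ₁ m σ₂) = B(σ₁) σ₂ m.
-- The fuel (length σ) always suffices since σ₁, σ₂ are strictly shorter.
B-fuel : ℕ → List ℕ → List ℕ
B-fuel zero σ = σ
B-fuel (suc k) [] = []
B-fuel (suc k) (x ∷ xs) with cut (maxOf (x ∷ xs)) (x ∷ xs)
... | σ₁ , σ₂ = B-fuel k σ₁ ++ σ₂ ++ [ maxOf (x ∷ xs) ]

B : List ℕ → List ℕ
B σ = B-fuel (length σ) σ

-- West's stack sort with fuel: S(α m β) = S(α) S(β) m.
S-fuel : ℕ → List ℕ → List ℕ
S-fuel zero σ = σ
S-fuel (suc k) [] = []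
S-fuel (suc k) (x ∷ xs) with cut (maxOf (x ∷ xs)) (x ∷ xs)
... | α , β = S-fuel k α ++ S-fuel k β ++ [ maxOf (x ∷ xs) ]

S : List ℕ → List ℕ
S σ = S-fuel (length σ) σ

Increasing : List ℕ → Set
Increasing [] = Data.Unit.⊤ where import Data.Unit
Increasing (x ∷ []) = Data.Unit.⊤ where import Data.Unit
Increasing (x ∷ y ∷ xs) = (x < y) × Increasing (y ∷ xs)

OrderIso : List ℕ → List ℕ → Set
OrderIso τ π = Σ (length τ ≡ length π) λ eq →
  ∀ (i j : Fin (length τ)) →
    (lookup τ i < lookup τ j) ⇔ (lookup π (cast eq i) < lookup π (cast eq j))

Contains : List ℕ → List ℕ → Set
Contains σ π = ∃[ τ ] (τ ⊆ σ × OrderIso τ π)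

Avoids : List (List ℕ) → List ℕ → Set
Avoids M σ = ∀ π → π ∈ M → ¬ Contains σ π

-- Write a list of distinct numbers as α M β with M its largest entry; then
-- S(α M β) = S(α) S(β) M and B(α M β) = B(α) β M.  Knuth's induction shows that
-- S(π) is increasing iff π avoids 231: both say that S(α) and S(β) are increasing
-- and every entry of α lies below every entry of β.  The same decomposition shows
-- that B(α) β M contains 231 iff α contains a quadruple w x y z with z smallest and
-- y above min(w, x), or β contains 231, or a 231 straddles α and β.  Since B(α) is
-- a rearrangement of α ending in max α, the straddling cases are again read off α,
-- and together the cases say that α M β contains such a quadruple, i.e. one of the
-- patterns 3241, 2341, 4231, 2431.

module Submission where

open import Defs
open import Data.Nat using (ℕ; zero; suc; _<_; _≤_; _≟_; s≤s; s≤s⁻¹; z<s; s<s)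
open import Data.Nat.Properties
  using (≤-refl; ≤-trans; <-trans; <-asym; <-irrefl; <-cmp; <-≤-trans; ≤∧≢⇒<; <⇒≢; <⇒≤;
         m≤m⊔n; m≤n⊔m; ≤-total; m≤n⇒m⊔n≡n; m≥n⇒m⊔n≡m; ⊔-identityʳ; suc-injective)
open import Data.Fin as Fin using (Fin; toℕ; cast; #_)
import Data.Fin.Properties as Fin
open import Data.List using (List; []; _∷_; [_]; _++_; length; lookup; map)
open import Data.List.Properties
  using (++-assoc; length-map; length-++-sucʳ; length-++-≤ˡ; length-++-≤ʳ)
open import Data.List.Membership.Propositional using (_∈_)
open import Data.List.Membership.Propositional.Properties using (∈-++⁻; ∈-++⁺ˡ; ∈-++⁺ʳ; ∈-lookup)
open import Data.List.Relation.Unary.Any using (here; there)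
import Data.List.Relation.Unary.All as All
open import Data.List.Relation.Unary.AllPairs as AllPairs using (AllPairs)
open import Data.List.Relation.Unary.Unique.Propositional using (Unique)
import Data.List.Relation.Unary.Unique.Propositional.Properties as Unique
open import Data.List.Relation.Binary.Sublist.Propositional
  using ([]; _∷_; _∷ʳ_; _⊆_; ⊆-refl; ⊆-trans; minimum; from∈; to∈)
open import Data.List.Relation.Binary.Sublist.Propositional.Properties
  using (++⁺; ++⁺ˡ; ++⁺ʳ; ∷ˡ⁻)
open import Data.List.Relation.Binary.Permutation.Propositional
  using (_↭_; ↭-refl; ↭-sym; ↭-trans; ↭-reflexive; ↭⇒↭ₛ)
import Data.List.Relation.Binary.Permutation.Propositional.Properties as ↭
open import Data.List.Relation.Binary.Permutation.Propositional.Properties using (∈-resp-↭)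
open import Data.Product using (_,_; _×_; proj₁; proj₂; ∃-syntax)
open import Data.Product.Function.NonDependent.Propositional using (_×-⇔_)
open import Data.Sum using (_⊎_; inj₁; inj₂; [_,_]′)
open import Data.Sum.Function.Propositional using (_⊎-⇔_)
open import Data.Empty using (⊥-elim)
open import Data.Unit using (tt)
open import Function using (_∘_)
open import Function.Bundles using (Equivalence; _⇔_; mk⇔)
open import Function.Construct.Composition using (_⇔-∘_)
open import Function.Construct.Identity using (⇔-id)
open import Function.Construct.Symmetry using (⇔-sym)
open import Function.Related.Propositional using (module EquationalReasoning)
open import Function.Related.TypeIsomorphisms using (¬-cong-⇔)
open import Relation.Nullary using (¬_; yes; no)
open import Relation.Binary.Definitions using (tri<; tri≈; tri>)
open import Relation.Binary.PropositionalEquality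
  using (_≡_; _≢_; refl; sym; trans; cong; subst; setoid)
open import Data.List.Relation.Binary.Permutation.Setoid.Properties (setoid ℕ)
  using (Unique-resp-↭)

private variable
  A : Set
  R : A → A → Set
  a b c : A
  xs ys τ : List A

record Split (xs ys τ : List A) : Set where
  constructor split
  field
    left right : List A
    τ≡left++right : τ ≡ left ++ right
    left⊆ : left ⊆ xs
    right⊆ : right ⊆ ys

⊆-++-split : ∀ xs → τ ⊆ xs ++ ys → Split xs ys τ
⊆-++-split [] s = split [] _ refl [] s
⊆-++-split (x ∷ xs) (.x ∷ʳ s) with ⊆-++-split xs s
... | split l r eq s₁ s₂ = split l r eq (x ∷ʳ s₁) s₂
⊆-++-split (x ∷ xs) (refl ∷ s) with ⊆-++-split xs s
... | split l r eq s₁ s₂ = split (x ∷ l) r (cong (x ∷_) eq) (refl ∷ s₁) s₂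

∷⊆⇒∈ : a ∷ xs ⊆ ys → a ∈ ys
∷⊆⇒∈ (_ ∷ʳ s) = there (∷⊆⇒∈ s)
∷⊆⇒∈ (refl ∷ _) = here refl

∈-tail-of-pair : ∀ {x} → a ∷ b ∷ [] ⊆ x ∷ xs → b ∈ xs
∈-tail-of-pair (_ ∷ʳ s) = ∷⊆⇒∈ (∷ˡ⁻ s)
∈-tail-of-pair (_ ∷ s) = ∷⊆⇒∈ s

pair⊈singleton : ¬ (a ∷ b ∷ [] ⊆ [ c ])
pair⊈singleton (_ ∷ʳ ())
pair⊈singleton (_ ∷ ())

∈-ordered : a ∈ xs → b ∈ xs → a ≢ b → (a ∷ b ∷ [] ⊆ xs) ⊎ (b ∷ a ∷ [] ⊆ xs)
∈-ordered (here refl) (here refl) a≢b = ⊥-elim (a≢b refl)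
∈-ordered (here refl) (there b∈) _ = inj₁ (refl ∷ from∈ b∈)
∈-ordered (there a∈) (here refl) _ = inj₂ (refl ∷ from∈ a∈)
∈-ordered {xs = x ∷ _} (there a∈) (there b∈) a≢b with ∈-ordered a∈ b∈ a≢b
... | inj₁ s = inj₁ (x ∷ʳ s)
... | inj₂ s = inj₂ (x ∷ʳ s)

length-split : ∀ {k} xs {y : A} ys → length (xs ++ y ∷ ys) ≤ suc k → length xs ≤ k × length ys ≤ k
length-split xs {y} ys len = ≤-trans (length-++-≤ˡ xs) len′ , ≤-trans (length-++-≤ʳ ys {xs}) len′
  where
  len′ = s≤s⁻¹ (subst (_≤ _) (length-++-sucʳ xs y ys) len)

Pairwise : (A → A → Set) → List A → Set
Pairwise R l = ∀ {a b} → a ∷ b ∷ [] ⊆ l → R a b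

Cross : (A → A → Set) → List A → List A → Set
Cross R xs ys = ∀ {a b} → a ∈ xs → b ∈ ys → R a b

Distinct : List A → Set
Distinct = Pairwise _≢_

AllPairs⇒Pairwise : AllPairs R xs → Pairwise R xs
AllPairs⇒Pairwise (_ AllPairs.∷ ps) (_ ∷ʳ s) = AllPairs⇒Pairwise ps s
AllPairs⇒Pairwise (p AllPairs.∷ _) (refl ∷ s) = All.lookup p (to∈ s)

Pairwise-⊆ : xs ⊆ ys → Pairwise R ys → Pairwise R xs
Pairwise-⊆ xs⊆ys p s = p (⊆-trans s xs⊆ys)

Pairwise-++ : ∀ xs → Pairwise R (xs ++ ys) ⇔ (Pairwise R xs × Pairwise R ys × Cross R xs ys)
Pairwise-++ {R = R} {ys = ys} xs = mk⇔ to from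
  where
  to : Pairwise R (xs ++ ys) → Pairwise R xs × Pairwise R ys × Cross R xs ys
  to p = (λ s → p (++⁺ʳ ys s)) , (λ s → p (++⁺ˡ xs s)) , λ a∈ b∈ → p (++⁺ (from∈ a∈) (from∈ b∈))

  from-split : Pairwise R xs → Pairwise R ys → Cross R xs ys → Split xs ys (a ∷ b ∷ []) → R a b
  from-split _ pys _ (split [] _ refl _ s₂) = pys s₂
  from-split _ _ cross (split (_ ∷ []) _ refl s₁ s₂) = cross (to∈ s₁) (to∈ s₂)
  from-split pxs _ _ (split (_ ∷ _ ∷ []) _ refl s₁ _) = pxs s₁
  from-split _ _ _ (split (_ ∷ _ ∷ _ ∷ _) _ () _ _)

  from : Pairwise R xs × Pairwise R ys × Cross R xs ys → Pairwise R (xs ++ ys)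
  from (pxs , pys , cross) s = from-split pxs pys cross (⊆-++-split xs s)

Cross-↭ : {xs′ ys′ : List A} → xs′ ↭ xs → ys′ ↭ ys → Cross R xs′ ys′ ⇔ Cross R xs ys
Cross-↭ xs′↭xs ys′↭ys = mk⇔
  (λ c {a} {b} a∈ b∈ → c (∈-resp-↭ (↭-sym xs′↭xs) a∈) (∈-resp-↭ (↭-sym ys′↭ys) b∈))
  (λ c {a} {b} a∈ b∈ → c (∈-resp-↭ xs′↭xs a∈) (∈-resp-↭ ys′↭ys b∈))

Increasing⇔Pairwise< : ∀ l → Increasing l ⇔ Pairwise _<_ l
Increasing⇔Pairwise< l = mk⇔ (to l) (from l)
  where
  head< : ∀ {x} l → Increasing (x ∷ l) → ∀ {b} → b ∈ l → x < b
  head< (y ∷ l) (x<y , _) (here refl) = x<y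
  head< (y ∷ l) (x<y , inc) (there b∈) = <-trans x<y (head< l inc b∈)

  tail : ∀ {x} l → Increasing (x ∷ l) → Increasing l
  tail [] _ = tt
  tail (_ ∷ _) (_ , inc) = inc

  to : ∀ l → Increasing l → Pairwise _<_ l
  to (x ∷ l) inc (_ ∷ʳ s) = to l (tail l inc) s
  to (x ∷ l) inc (refl ∷ s) = head< l inc (to∈ s)

  from : ∀ l → Pairwise _<_ l → Increasing l
  from [] _ = tt
  from (_ ∷ []) _ = tt
  from (x ∷ y ∷ l) p = p (refl ∷ refl ∷ minimum l) , from (y ∷ l) (λ s → p (x ∷ʳ s))

-- Splitting at the maximum

≤maxOf : ∀ {l} → a ∈ l → a ≤ maxOf l
≤maxOf {l = x ∷ l} (here refl) = m≤m⊔n x (maxOf l)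
≤maxOf {l = x ∷ l} (there a∈) = ≤-trans (≤maxOf a∈) (m≤n⊔m x (maxOf l))

maxOf-∈-∷ : ∀ x xs → maxOf (x ∷ xs) ∈ x ∷ xs
maxOf-∈-∷ x [] = here (⊔-identityʳ x)
maxOf-∈-∷ x (y ∷ xs) with ≤-total x (maxOf (y ∷ xs))
... | inj₁ x≤m = there (subst (_∈ y ∷ xs) (sym (m≤n⇒m⊔n≡n x≤m)) (maxOf-∈-∷ y xs))
... | inj₂ m≤x = here (m≥n⇒m⊔n≡m m≤x)

maxOf-∈ : ∀ {l} → a ∈ l → maxOf l ∈ l
maxOf-∈ {l = x ∷ xs} _ = maxOf-∈-∷ x xs

cut-∈ : ∀ {m l} → m ∈ l → l ≡ proj₁ (cut m l) ++ m ∷ proj₂ (cut m l)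
cut-∈ {m} {x ∷ xs} m∈ with x ≟ m | m∈
... | yes x≡m | _ = cong (_∷ xs) x≡m
... | no x≢m | here m≡x = ⊥-elim (x≢m (sym m≡x))
... | no _ | there m∈xs = cong (x ∷_) (cut-∈ m∈xs)

S-fuel-↭ : ∀ k l → S-fuel k l ↭ l
S-fuel-↭ zero l = ↭-refl
S-fuel-↭ (suc k) [] = ↭-refl
S-fuel-↭ (suc k) (x ∷ xs) with cut (maxOf (x ∷ xs)) (x ∷ xs) | cut-∈ (maxOf-∈-∷ x xs)
... | α , β | l≡ = ↭-trans (↭.++⁺ (S-fuel-↭ k α) (↭.++⁺ʳ _ (S-fuel-↭ k β)))
                   (↭-trans (↭.++⁺ˡ α (↭.++-comm β _)) (↭-reflexive (sym l≡)))

B-fuel-↭ : ∀ k l → B-fuel k l ↭ l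
B-fuel-↭ zero l = ↭-refl
B-fuel-↭ (suc k) [] = ↭-refl
B-fuel-↭ (suc k) (x ∷ xs) with cut (maxOf (x ∷ xs)) (x ∷ xs) | cut-∈ (maxOf-∈-∷ x xs)
... | α , β | l≡ = ↭-trans (↭.++⁺ʳ _ (B-fuel-↭ k α))
                   (↭-trans (↭.++⁺ˡ α (↭.++-comm β _)) (↭-reflexive (sym l≡)))

B-fuel-ends-with-max : ∀ k l {e} → length l ≤ k → e ∈ l → e < maxOf l →
  e ∷ maxOf l ∷ [] ⊆ B-fuel k l
B-fuel-ends-with-max zero (x ∷ xs) () _ _
B-fuel-ends-with-max (suc k) (x ∷ xs) len e∈ e<m
  with cut (maxOf (x ∷ xs)) (x ∷ xs) | cut-∈ (maxOf-∈-∷ x xs)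
... | α , β | l≡ with ∈-++⁻ α (subst (_ ∈_) l≡ e∈)
...   | inj₁ e∈α = ++⁺ (from∈ (∈-resp-↭ (↭-sym (B-fuel-↭ k α)) e∈α)) (++⁺ˡ β (refl ∷ []))
...   | inj₂ (here refl) = ⊥-elim (<-irrefl refl e<m)
...   | inj₂ (there e∈β) = ++⁺ˡ (B-fuel k α) (++⁺ (from∈ e∈β) (refl ∷ []))

record Peak (α : List ℕ) (M : ℕ) (β : List ℕ) : Set where
  field
    distinct : Distinct (α ++ M ∷ β)
    α<M : ∀ {a} → a ∈ α → a < M
    β<M : ∀ {b} → b ∈ β → b < M

  distinctˡ : Distinct α
  distinctˡ = Pairwise-⊆ (++⁺ʳ (M ∷ β) ⊆-refl) distinct

  distinctʳ : Distinct β
  distinctʳ = Pairwise-⊆ (++⁺ˡ α (M ∷ʳ ⊆-refl)) distinct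

peak : ∀ {l α M β} → l ≡ α ++ M ∷ β → (∀ {a} → a ∈ l → a ≤ M) → Distinct l → Peak α M β
peak {α = α} {M} {β} refl ≤M d = record
  { distinct = d
  ; α<M = λ a∈ → ≤∧≢⇒< (≤M (∈-++⁺ˡ a∈)) (d (++⁺ (from∈ a∈) (refl ∷ minimum β)))
  ; β<M = λ b∈ → ≤∧≢⇒< (≤M (∈-++⁺ʳ α (there b∈))) (d (++⁺ˡ α (refl ∷ from∈ b∈)) ∘ sym)
  }

-- Stack sorting and the pattern 231

data Contains231 (l : List ℕ) : Set where
  231-at : ∀ {a b c} → a ∷ b ∷ c ∷ [] ⊆ l → c < a → a < b → Contains231 l

data Across231 (xs ys : List ℕ) : Set where
  2-31 : ∀ {a b c} → a ∈ xs → b ∷ c ∷ [] ⊆ ys → c < a → a < b → Across231 xs ys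
  23-1 : ∀ {a b c} → a ∷ b ∷ [] ⊆ xs → c ∈ ys → c < a → a < b → Across231 xs ys

¬Contains231-[] : ¬ Contains231 []
¬Contains231-[] (231-at () _ _)

Contains231-++ : ∀ (xs : List ℕ) {ys} →
  Contains231 (xs ++ ys) ⇔ (Contains231 xs ⊎ Contains231 ys ⊎ Across231 xs ys)
Contains231-++ xs {ys} = mk⇔ to from
  where
  to-split : ∀ {a b c} → c < a → a < b → Split xs ys (a ∷ b ∷ c ∷ []) →
    Contains231 xs ⊎ Contains231 ys ⊎ Across231 xs ys
  to-split c<a a<b (split [] _ refl _ s₂) = inj₂ (inj₁ (231-at s₂ c<a a<b))
  to-split c<a a<b (split (_ ∷ []) _ refl s₁ s₂) = inj₂ (inj₂ (2-31 (to∈ s₁) s₂ c<a a<b))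
  to-split c<a a<b (split (_ ∷ _ ∷ []) _ refl s₁ s₂) = inj₂ (inj₂ (23-1 s₁ (to∈ s₂) c<a a<b))
  to-split c<a a<b (split (_ ∷ _ ∷ _ ∷ []) _ refl s₁ _) = inj₁ (231-at s₁ c<a a<b)
  to-split _ _ (split (_ ∷ _ ∷ _ ∷ _ ∷ _) _ () _ _)

  to : Contains231 (xs ++ ys) → Contains231 xs ⊎ Contains231 ys ⊎ Across231 xs ys
  to (231-at s c<a a<b) = to-split c<a a<b (⊆-++-split xs s)

  from : Contains231 xs ⊎ Contains231 ys ⊎ Across231 xs ys → Contains231 (xs ++ ys)
  from (inj₁ (231-at s c<a a<b)) = 231-at (++⁺ʳ ys s) c<a a<b
  from (inj₂ (inj₁ (231-at s c<a a<b))) = 231-at (++⁺ˡ xs s) c<a a<b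
  from (inj₂ (inj₂ (2-31 a∈ s c<a a<b))) = 231-at (++⁺ (from∈ a∈) s) c<a a<b
  from (inj₂ (inj₂ (23-1 s c∈ c<a a<b))) = 231-at (++⁺ s (from∈ c∈)) c<a a<b

Contains231-++-max : ∀ {xs M} → (∀ {a} → a ∈ xs → a ≤ M) →
  Contains231 (xs ++ [ M ]) ⇔ Contains231 xs
Contains231-++-max {xs} {M} xs≤M = mk⇔ to (λ h → Equivalence.from (Contains231-++ xs) (inj₁ h))
  where
  to : Contains231 (xs ++ [ M ]) → Contains231 xs
  to h with Equivalence.to (Contains231-++ xs) h
  ... | inj₁ h′ = h′
  ... | inj₂ (inj₁ (231-at (_ ∷ʳ ()) _ _))
  ... | inj₂ (inj₁ (231-at (_ ∷ ()) _ _))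
  ... | inj₂ (inj₂ (2-31 _ s _ _)) = ⊥-elim (pair⊈singleton s)
  ... | inj₂ (inj₂ (23-1 s (here refl) M<a _)) = ⊥-elim (<-irrefl refl (<-≤-trans M<a (xs≤M (to∈ s))))

avoids231-peak : ∀ {α M β} → Peak α M β →
  (¬ Contains231 (α ++ M ∷ β)) ⇔ (¬ Contains231 α × ¬ Contains231 β × Cross _<_ α β)
avoids231-peak {α} {M} {β} P = mk⇔ to from
  where
  open Peak P
  decompose = Contains231-++ α {M ∷ β}

  to : ¬ Contains231 (α ++ M ∷ β) → ¬ Contains231 α × ¬ Contains231 β × Cross _<_ α β
  to n = (λ h → n (Equivalence.from decompose (inj₁ h)))
       , (λ { (231-at s c<a a<b) → n (Equivalence.from decompose (inj₂ (inj₁ (231-at (M ∷ʳ s) c<a a<b)))) })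
       , cross
    where
    cross : Cross _<_ α β
    cross {a} {c} a∈ c∈ with <-cmp a c
    ... | tri< a<c _ _ = a<c
    ... | tri≈ _ a≡c _ = ⊥-elim (distinct (++⁺ (from∈ a∈) (M ∷ʳ from∈ c∈)) a≡c)
    ... | tri> _ _ c<a = ⊥-elim (n (231-at (++⁺ (from∈ a∈) (refl ∷ from∈ c∈)) c<a (α<M a∈)))

  from : ¬ Contains231 α × ¬ Contains231 β × Cross _<_ α β → ¬ Contains231 (α ++ M ∷ β)
  from (nα , nβ , cross) h with Equivalence.to decompose h
  ... | inj₁ h′ = nα h′
  ... | inj₂ (inj₁ (231-at (_ ∷ʳ s) c<a a<b)) = nβ (231-at s c<a a<b)
  ... | inj₂ (inj₁ (231-at (refl ∷ s) _ M<b)) = <-asym M<b (β<M (∷⊆⇒∈ s))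
  ... | inj₂ (inj₂ (2-31 a∈ s c<a _)) = <-asym c<a (cross a∈ (∈-tail-of-pair s))
  ... | inj₂ (inj₂ (23-1 s (here refl) M<a _)) = <-asym M<a (α<M (∷⊆⇒∈ s))
  ... | inj₂ (inj₂ (23-1 s (there c∈) c<a _)) = <-asym c<a (cross (∷⊆⇒∈ s) c∈)

increasing-peak : ∀ {xs ys M} → (∀ {a} → a ∈ xs → a < M) → (∀ {b} → b ∈ ys → b < M) →
  Pairwise _<_ (xs ++ ys ++ [ M ]) ⇔ (Pairwise _<_ xs × Pairwise _<_ ys × Cross _<_ xs ys)
increasing-peak {xs} {ys} {M} xs<M ys<M = mk⇔ to from
  where
  to : Pairwise _<_ (xs ++ ys ++ [ M ]) → Pairwise _<_ xs × Pairwise _<_ ys × Cross _<_ xs ys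
  to p with Equivalence.to (Pairwise-++ xs) p
  ... | pxs , pysM , cross =
    pxs , proj₁ (Equivalence.to (Pairwise-++ ys) pysM) , λ a∈ b∈ → cross a∈ (∈-++⁺ˡ b∈)

  from : Pairwise _<_ xs × Pairwise _<_ ys × Cross _<_ xs ys → Pairwise _<_ (xs ++ ys ++ [ M ])
  from (pxs , pys , cross) = Equivalence.from (Pairwise-++ xs) (pxs , pysM , crossM)
    where
    pysM : Pairwise _<_ (ys ++ [ M ])
    pysM = Equivalence.from (Pairwise-++ ys)
      (pys , (λ s → ⊥-elim (pair⊈singleton s)) , λ { b∈ (here refl) → ys<M b∈ })

    crossM : Cross _<_ xs (ys ++ [ M ])
    crossM a∈ b∈ with ∈-++⁻ ys b∈
    ... | inj₁ b∈ys = cross a∈ b∈ys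
    ... | inj₂ (here refl) = xs<M a∈

S-step : ∀ {α β Sα Sβ M} → Sα ↭ α → Sβ ↭ β →
  (Pairwise _<_ Sα ⇔ (¬ Contains231 α)) → (Pairwise _<_ Sβ ⇔ (¬ Contains231 β)) → Peak α M β →
  Pairwise _<_ (Sα ++ Sβ ++ [ M ]) ⇔ (¬ Contains231 (α ++ M ∷ β))
S-step {α} {β} {Sα} {Sβ} {M} Sα↭α Sβ↭β IHα IHβ P = begin
  Pairwise _<_ (Sα ++ Sβ ++ [ M ])
    ∼⟨ increasing-peak (λ a∈ → α<M (∈-resp-↭ Sα↭α a∈)) (λ b∈ → β<M (∈-resp-↭ Sβ↭β b∈)) ⟩
  (Pairwise _<_ Sα × Pairwise _<_ Sβ × Cross _<_ Sα Sβ)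
    ∼⟨ IHα ×-⇔ IHβ ×-⇔ Cross-↭ Sα↭α Sβ↭β ⟩
  (¬ Contains231 α × ¬ Contains231 β × Cross _<_ α β)
    ∼⟨ ⇔-sym (avoids231-peak P) ⟩
  (¬ Contains231 (α ++ M ∷ β)) ∎
  where
  open Peak P
  open EquationalReasoning

S-sorts⇔avoids231 : ∀ k l → length l ≤ k → Distinct l → Pairwise _<_ (S-fuel k l) ⇔ (¬ Contains231 l)
S-sorts⇔avoids231 zero [] _ _ = mk⇔ (λ _ → ¬Contains231-[]) (λ _ ())
S-sorts⇔avoids231 (suc k) [] _ _ = mk⇔ (λ _ → ¬Contains231-[]) (λ _ ())
S-sorts⇔avoids231 (suc k) (x ∷ xs) len d
  with cut (maxOf (x ∷ xs)) (x ∷ xs) | cut-∈ (maxOf-∈-∷ x xs)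
... | α , β | l≡ =
  subst (λ l → Pairwise _<_ (S-fuel k α ++ S-fuel k β ++ [ maxOf (x ∷ xs) ]) ⇔ (¬ Contains231 l))
    (sym l≡)
    (S-step (S-fuel-↭ k α) (S-fuel-↭ k β)
      (S-sorts⇔avoids231 k α (proj₁ short) distinctˡ)
      (S-sorts⇔avoids231 k β (proj₂ short) distinctʳ) P)
  where
  P = peak l≡ ≤maxOf d
  open Peak P using (distinctˡ; distinctʳ)
  short = length-split α β (subst (λ l → length l ≤ suc k) l≡ len)

-- A bubble sort pass and the quadruple patterns

-- For distinct entries these are exactly the occurrences of 3241, 2341, 4231 or 2431.
data ContainsForbidden (l : List ℕ) : Set where
  forbidden-at : ∀ {w x y z} → w ∷ x ∷ y ∷ z ∷ [] ⊆ l → z < w → z < x → w < y ⊎ x < y →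
    ContainsForbidden l

data Straddle (α β : List ℕ) : Set where
  split-2-31 : ∀ {a b c} → a ∈ α → b ∷ c ∷ [] ⊆ β → c < a → a < b → Straddle α β
  under-max : ∀ {e z} → e ∈ α → z ∈ β → z < e → e < maxOf α → Straddle α β

Across231⇔Straddle : ∀ {α β Bα} → Bα ↭ α →
  (∀ {e} → e ∈ α → e < maxOf α → e ∷ maxOf α ∷ [] ⊆ Bα) →
  Across231 Bα β ⇔ Straddle α β
Across231⇔Straddle Bα↭α ends-with-max = mk⇔ to from
  where
  to : Across231 _ _ → Straddle _ _
  to (2-31 a∈ s c<a a<b) = split-2-31 (∈-resp-↭ Bα↭α a∈) s c<a a<b
  to (23-1 s c∈ c<a a<b) =
    under-max (∈-resp-↭ Bα↭α (∷⊆⇒∈ s)) c∈ c<a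
      (<-≤-trans a<b (≤maxOf (∈-resp-↭ Bα↭α (∷⊆⇒∈ (∷ˡ⁻ s)))))

  from : Straddle _ _ → Across231 _ _
  from (split-2-31 a∈ s c<a a<b) = 2-31 (∈-resp-↭ (↭-sym Bα↭α) a∈) s c<a a<b
  from (under-max e∈ z∈ z<e e<m) = 23-1 (ends-with-max e∈ e<m) z∈ z<e e<m

-- Of two distinct entries of α, at least one is not its maximum.
under-max-of-pair : ∀ {α β w x z} → Distinct α → w ∷ x ∷ [] ⊆ α → z ∈ β → z < w → z < x →
  Straddle α β
under-max-of-pair {α} {w = w} {x} d s z∈ z<w z<x with w ≟ maxOf α
... | no w≢m = under-max (∷⊆⇒∈ s) z∈ z<w (≤∧≢⇒< (≤maxOf (∷⊆⇒∈ s)) w≢m)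
... | yes w≡m = under-max x∈ z∈ z<x (≤∧≢⇒< (≤maxOf x∈) (λ x≡m → d s (trans w≡m (sym x≡m))))
  where x∈ = ∷⊆⇒∈ (∷ˡ⁻ s)

forbidden-peak : ∀ {α M β} → Peak α M β →
  ContainsForbidden (α ++ M ∷ β) ⇔ (ContainsForbidden α ⊎ Contains231 β ⊎ Straddle α β)
forbidden-peak {α} {M} {β} P = mk⇔ to from
  where
  open Peak P
  Cases = ContainsForbidden α ⊎ Contains231 β ⊎ Straddle α β

  in-β : Contains231 β → Cases
  in-β h = inj₂ (inj₁ h)

  straddle : Straddle α β → Cases
  straddle h = inj₂ (inj₂ h)

  to-split : ∀ {w x y z} → z < w → z < x → w < y ⊎ x < y →
    Split α (M ∷ β) (w ∷ x ∷ y ∷ z ∷ []) → Cases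
  to-split z<w _ (inj₁ w<y) (split [] _ refl _ (_ ∷ʳ s)) =
    in-β (231-at (⊆-trans (refl ∷ _ ∷ʳ refl ∷ refl ∷ []) s) z<w w<y)
  to-split _ z<x (inj₂ x<y) (split [] _ refl _ (_ ∷ʳ s)) = in-β (231-at (∷ˡ⁻ s) z<x x<y)
  to-split _ _ (inj₁ M<y) (split [] _ refl _ (refl ∷ s)) = ⊥-elim (<-asym M<y (β<M (∷⊆⇒∈ (∷ˡ⁻ s))))
  to-split _ z<x (inj₂ x<y) (split [] _ refl _ (refl ∷ s)) = in-β (231-at s z<x x<y)
  to-split z<w _ (inj₁ w<y) (split (_ ∷ []) _ refl s₁ (_ ∷ʳ s)) =
    straddle (split-2-31 (to∈ s₁) (∷ˡ⁻ s) z<w w<y)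
  to-split _ z<x (inj₂ x<y) (split (_ ∷ []) _ refl _ (_ ∷ʳ s)) = in-β (231-at s z<x x<y)
  to-split z<w _ (inj₁ w<y) (split (_ ∷ []) _ refl s₁ (refl ∷ s)) = straddle (split-2-31 (to∈ s₁) s z<w w<y)
  to-split _ _ (inj₂ M<y) (split (_ ∷ []) _ refl _ (refl ∷ s)) = ⊥-elim (<-asym M<y (β<M (∷⊆⇒∈ s)))
  to-split z<w z<x _ (split (_ ∷ _ ∷ []) _ refl s₁ s₂) =
    straddle (under-max-of-pair distinctˡ s₁ (∈-tail-of-pair s₂) z<w z<x)
  to-split z<w z<x _ (split (_ ∷ _ ∷ _ ∷ []) _ refl s₁ (_ ∷ʳ s)) =
    straddle (under-max-of-pair distinctˡ (⊆-trans (refl ∷ refl ∷ _ ∷ʳ []) s₁) (to∈ s) z<w z<x)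
  to-split M<w _ _ (split (_ ∷ _ ∷ _ ∷ []) _ refl s₁ (refl ∷ _)) = ⊥-elim (<-asym M<w (α<M (∷⊆⇒∈ s₁)))
  to-split z<w z<x wxy (split (_ ∷ _ ∷ _ ∷ _ ∷ []) _ refl s₁ _) = inj₁ (forbidden-at s₁ z<w z<x wxy)
  to-split _ _ _ (split (_ ∷ _ ∷ _ ∷ _ ∷ _ ∷ _) _ () _ _)

  to : ContainsForbidden (α ++ M ∷ β) → Cases
  to (forbidden-at s z<w z<x wxy) = to-split z<w z<x wxy (⊆-++-split α s)

  from : Cases → ContainsForbidden (α ++ M ∷ β)
  from (inj₁ (forbidden-at s z<w z<x wxy)) = forbidden-at (++⁺ʳ (M ∷ β) s) z<w z<x wxy
  from (inj₂ (inj₁ (231-at s c<a a<b))) =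
    forbidden-at (++⁺ˡ α (refl ∷ s)) (β<M (∷⊆⇒∈ (∷ˡ⁻ (∷ˡ⁻ s)))) c<a (inj₂ a<b)
  from (inj₂ (inj₂ (split-2-31 a∈ s c<a a<b))) =
    forbidden-at (++⁺ (from∈ a∈) (refl ∷ s)) c<a (β<M (∷⊆⇒∈ (∷ˡ⁻ s))) (inj₁ a<b)
  from (inj₂ (inj₂ (under-max e∈ z∈ z<e e<m))) with ∈-ordered e∈ (maxOf-∈ e∈) (<⇒≢ e<m)
  ... | inj₁ s = forbidden-at (++⁺ s (refl ∷ from∈ z∈)) z<e (<-trans z<e e<m) (inj₁ (α<M e∈))
  ... | inj₂ s = forbidden-at (++⁺ s (refl ∷ from∈ z∈)) (<-trans z<e e<m) z<e (inj₂ (α<M e∈))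

B-step : ∀ {α β Bα M} → Bα ↭ α →
  (∀ {e} → e ∈ α → e < maxOf α → e ∷ maxOf α ∷ [] ⊆ Bα) →
  (Contains231 Bα ⇔ ContainsForbidden α) → Peak α M β →
  Contains231 (Bα ++ β ++ [ M ]) ⇔ ContainsForbidden (α ++ M ∷ β)
B-step {α} {β} {Bα} {M} Bα↭α ends-with-max IH P = begin
  Contains231 (Bα ++ β ++ [ M ])
    ≡⟨ cong Contains231 (sym (++-assoc Bα β [ M ])) ⟩
  Contains231 ((Bα ++ β) ++ [ M ])
    ∼⟨ Contains231-++-max ≤M ⟩
  Contains231 (Bα ++ β)
    ∼⟨ Contains231-++ Bα ⟩
  (Contains231 Bα ⊎ Contains231 β ⊎ Across231 Bα β)
    ∼⟨ IH ⊎-⇔ ⇔-id _ ⊎-⇔ Across231⇔Straddle Bα↭α ends-with-max ⟩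
  (ContainsForbidden α ⊎ Contains231 β ⊎ Straddle α β)
    ∼⟨ ⇔-sym (forbidden-peak P) ⟩
  ContainsForbidden (α ++ M ∷ β) ∎
  where
  open Peak P
  open EquationalReasoning

  ≤M : ∀ {a} → a ∈ Bα ++ β → a ≤ M
  ≤M a∈ with ∈-++⁻ Bα a∈
  ... | inj₁ a∈Bα = <⇒≤ (α<M (∈-resp-↭ Bα↭α a∈Bα))
  ... | inj₂ a∈β = <⇒≤ (β<M a∈β)

B-contains231⇔forbidden : ∀ k l → length l ≤ k → Distinct l → Contains231 (B-fuel k l) ⇔ ContainsForbidden l
B-contains231⇔forbidden zero [] _ _ = mk⇔ (⊥-elim ∘ ¬Contains231-[]) (λ { (forbidden-at () _ _ _) })
B-contains231⇔forbidden (suc k) [] _ _ = mk⇔ (⊥-elim ∘ ¬Contains231-[]) (λ { (forbidden-at () _ _ _) })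
B-contains231⇔forbidden (suc k) (x ∷ xs) len d
  with cut (maxOf (x ∷ xs)) (x ∷ xs) | cut-∈ (maxOf-∈-∷ x xs)
... | α , β | l≡ =
  subst (λ l → Contains231 (B-fuel k α ++ β ++ [ maxOf (x ∷ xs) ]) ⇔ ContainsForbidden l) (sym l≡)
    (B-step (B-fuel-↭ k α) (B-fuel-ends-with-max k α (proj₁ short))
      (B-contains231⇔forbidden k α (proj₁ short) (Peak.distinctˡ P)) P)
  where
  P = peak l≡ ≤maxOf d
  short = length-split α β (subst (λ l → length l ≤ suc k) l≡ len)

-- Order isomorphisms with the four patterns

patterns : List (List ℕ)
patterns =
  (3 ∷ 2 ∷ 4 ∷ 1 ∷ []) ∷ (2 ∷ 3 ∷ 4 ∷ 1 ∷ []) ∷ (4 ∷ 2 ∷ 3 ∷ 1 ∷ []) ∷ (2 ∷ 4 ∷ 3 ∷ 1 ∷ []) ∷ []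

lookup-map₂ : ∀ (f g : A → ℕ) π (i : Fin (length (map f π)))
  .(eq : length (map f π) ≡ length (map g π)) →
  ∃[ a ] lookup (map f π) i ≡ f a × lookup (map g π) (cast eq i) ≡ g a
lookup-map₂ f g (p ∷ π) Fin.zero eq = p , refl , refl
lookup-map₂ f g (p ∷ π) (Fin.suc i) eq = lookup-map₂ f g π i (suc-injective eq)

OrderIso-map : ∀ (f g : A → ℕ) → (∀ a b → (f a < f b) ⇔ (g a < g b)) →
  ∀ π → OrderIso (map f π) (map g π)
OrderIso-map f g f<⇔g< π = eq , iso
  where
  eq = trans (length-map f π) (sym (length-map g π))
  iso : ∀ i j → (lookup (map f π) i < lookup (map f π) j) ⇔
                (lookup (map g π) (cast eq i) < lookup (map g π) (cast eq j))
  iso i j with lookup-map₂ f g π i eq | lookup-map₂ f g π j eq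
  ... | a , fi , gi | b , fj , gj rewrite fi | gi | fj | gj = f<⇔g< a b

OrderIso-reflects< : ∀ {τ π} (iso : OrderIso τ π) (i j : Fin (length τ)) →
  lookup π (cast (proj₁ iso) i) < lookup π (cast (proj₁ iso) j) → lookup τ i < lookup τ j
OrderIso-reflects< (_ , iso) i j = Equivalence.from (iso i j)

lookup-⊆ : ∀ (v : List A) {i j} → i Fin.< j → lookup v i ∷ lookup v j ∷ [] ⊆ v
lookup-⊆ (x ∷ v) {Fin.zero} {Fin.suc j} _ = refl ∷ from∈ (∈-lookup j)
lookup-⊆ (x ∷ v) {Fin.suc i} {Fin.suc j} (s≤s i<j) = x ∷ʳ lookup-⊆ v i<j

Increasing-lookup : ∀ v → Increasing v → ∀ i j → (lookup v i < lookup v j) ⇔ (i Fin.< j)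
Increasing-lookup v inc i j = mk⇔ to (λ i<j → increasing (lookup-⊆ v i<j))
  where
  increasing = Equivalence.to (Increasing⇔Pairwise< v) inc
  to : lookup v i < lookup v j → i Fin.< j
  to vi<vj with Fin.<-cmp i j
  ... | tri< i<j _ _ = i<j
  ... | tri≈ _ refl _ = ⊥-elim (<-irrefl refl vi<vj)
  ... | tri> _ _ j<i = ⊥-elim (<-asym vi<vj (increasing (lookup-⊆ v j<i)))

-- Reading the entries of π as positions in the increasing list v, a sublist
-- listing v in the order π is an occurrence of π (shifted to start at 1).
Contains-chain : ∀ {σ} v → Increasing v → (π : List (Fin (length v))) → map (lookup v) π ⊆ σ →
  Contains σ (map (suc ∘ toℕ) π)
Contains-chain v inc π s = map (lookup v) π , s , OrderIso-map (lookup v) (suc ∘ toℕ) f<⇔g< π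
  where
  f<⇔g< : ∀ a b → (lookup v a < lookup v b) ⇔ (suc (toℕ a) < suc (toℕ b))
  f<⇔g< a b = mk⇔ s≤s s≤s⁻¹ ⇔-∘ Increasing-lookup v inc a b

forbidden⇒pattern : ∀ {σ} → Distinct σ → ContainsForbidden σ → ∃[ π ] π ∈ patterns × Contains σ π
forbidden⇒pattern d (forbidden-at {w} {x} {y} {z} s z<w z<x w<y⊎x<y) with <-cmp w x
... | tri≈ _ w≡x _ = ⊥-elim (d (⊆-trans (refl ∷ refl ∷ y ∷ʳ z ∷ʳ []) s) w≡x)
... | tri< w<x _ _ with <-cmp x y
...   | tri< x<y _ _ =
        _ , there (here refl) ,
        Contains-chain (z ∷ w ∷ x ∷ y ∷ []) (z<w , w<x , x<y , tt) (# 1 ∷ # 2 ∷ # 3 ∷ # 0 ∷ []) s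
...   | tri≈ _ x≡y _ = ⊥-elim (d (⊆-trans (w ∷ʳ refl ∷ refl ∷ z ∷ʳ []) s) x≡y)
...   | tri> _ _ y<x =
        _ , there (there (there (here refl))) ,
        Contains-chain (z ∷ w ∷ y ∷ x ∷ []) (z<w , w<y , y<x , tt) (# 1 ∷ # 3 ∷ # 2 ∷ # 0 ∷ []) s
  where w<y = [ (λ w<y → w<y) , (λ x<y → ⊥-elim (<-asym x<y y<x)) ]′ w<y⊎x<y
forbidden⇒pattern d (forbidden-at {w} {x} {y} {z} s z<w z<x w<y⊎x<y) | tri> _ _ x<w with <-cmp w y
...   | tri< w<y _ _ =
        _ , here refl ,
        Contains-chain (z ∷ x ∷ w ∷ y ∷ []) (z<x , x<w , w<y , tt) (# 2 ∷ # 1 ∷ # 3 ∷ # 0 ∷ []) s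
...   | tri≈ _ w≡y _ = ⊥-elim (d (⊆-trans (refl ∷ x ∷ʳ refl ∷ z ∷ʳ []) s) w≡y)
...   | tri> _ _ y<w =
        _ , there (there (here refl)) ,
        Contains-chain (z ∷ x ∷ y ∷ w ∷ []) (z<x , x<y , y<w , tt) (# 3 ∷ # 1 ∷ # 2 ∷ # 0 ∷ []) s
  where x<y = [ (λ w<y → ⊥-elim (<-asym w<y y<w)) , (λ x<y → x<y) ]′ w<y⊎x<y

pattern-shape : ∀ {w x y z π} → π ∈ patterns → OrderIso (w ∷ x ∷ y ∷ z ∷ []) π →
  z < w × z < x × (w < y ⊎ x < y)
pattern-shape (here refl) iso =
  OrderIso-reflects< iso (# 3) (# 0) (s<s z<s) ,
  OrderIso-reflects< iso (# 3) (# 1) (s<s z<s) ,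
  inj₁ (OrderIso-reflects< iso (# 0) (# 2) (s<s (s<s (s<s z<s))))
pattern-shape (there (here refl)) iso =
  OrderIso-reflects< iso (# 3) (# 0) (s<s z<s) ,
  OrderIso-reflects< iso (# 3) (# 1) (s<s z<s) ,
  inj₁ (OrderIso-reflects< iso (# 0) (# 2) (s<s (s<s z<s)))
pattern-shape (there (there (here refl))) iso =
  OrderIso-reflects< iso (# 3) (# 0) (s<s z<s) ,
  OrderIso-reflects< iso (# 3) (# 1) (s<s z<s) ,
  inj₂ (OrderIso-reflects< iso (# 1) (# 2) (s<s (s<s z<s)))
pattern-shape (there (there (there (here refl)))) iso =
  OrderIso-reflects< iso (# 3) (# 0) (s<s z<s) ,
  OrderIso-reflects< iso (# 3) (# 1) (s<s z<s) ,
  inj₁ (OrderIso-reflects< iso (# 0) (# 2) (s<s (s<s z<s)))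

pattern-length : ∀ {π} → π ∈ patterns → length π ≡ 4
pattern-length (here refl) = refl
pattern-length (there (here refl)) = refl
pattern-length (there (there (here refl))) = refl
pattern-length (there (there (there (here refl)))) = refl

length-≡4 : ∀ {τ : List A} → length τ ≡ 4 → ∃[ w ] ∃[ x ] ∃[ y ] ∃[ z ] τ ≡ w ∷ x ∷ y ∷ z ∷ []
length-≡4 {τ = w ∷ x ∷ y ∷ z ∷ []} refl = w , x , y , z , refl

pattern⇒forbidden : ∀ {σ π} → π ∈ patterns → Contains σ π → ContainsForbidden σ
pattern⇒forbidden π∈ (τ , s , iso) with length-≡4 {τ = τ} (trans (proj₁ iso) (pattern-length π∈))
... | _ , _ , _ , _ , refl with pattern-shape π∈ iso
...   | z<w , z<x , w<y⊎x<y = forbidden-at s z<w z<x w<y⊎x<y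

avoids⇔¬forbidden : ∀ {σ} → Distinct σ → Avoids patterns σ ⇔ (¬ ContainsForbidden σ)
avoids⇔¬forbidden d = mk⇔
  (λ av h → let π , π∈ , c = forbidden⇒pattern d h in av π π∈ c)
  (λ n π π∈ c → n (pattern⇒forbidden π∈ c))

IsPerm⇒Unique : ∀ {σ} → IsPerm σ → Unique σ
IsPerm⇒Unique {σ} (_ , σ↭) =
  Unique-resp-↭ (↭⇒↭ₛ (↭-sym σ↭)) (Unique.map⁺ suc-injective (Unique.upTo⁺ (length σ)))

proposition3p4 : (σ : List ℕ) → IsPerm σ →
    (Increasing (S (B σ)) ⇔
     Avoids ((3 ∷ 2 ∷ 4 ∷ 1 ∷ []) ∷ (2 ∷ 3 ∷ 4 ∷ 1 ∷ []) ∷ (4 ∷ 2 ∷ 3 ∷ 1 ∷ []) ∷ (2 ∷ 4 ∷ 3 ∷ 1 ∷ []) ∷ []) σ)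
proposition3p4 σ σ-perm = begin
  Increasing (S (B σ))
    ∼⟨ Increasing⇔Pairwise< (S (B σ)) ⟩
  Pairwise _<_ (S (B σ))
    ∼⟨ S-sorts⇔avoids231 (length (B σ)) (B σ) ≤-refl (AllPairs⇒Pairwise unique-Bσ) ⟩
  (¬ Contains231 (B σ))
    ∼⟨ ¬-cong-⇔ (B-contains231⇔forbidden (length σ) σ ≤-refl (AllPairs⇒Pairwise unique-σ)) ⟩
  (¬ ContainsForbidden σ)
    ∼⟨ ⇔-sym (avoids⇔¬forbidden (AllPairs⇒Pairwise unique-σ)) ⟩
  Avoids patterns σ ∎
  where
  open EquationalReasoning
  unique-σ = IsPerm⇒Unique σ-perm
  unique-Bσ = Unique-resp-↭ (↭⇒↭ₛ (↭-sym (B-fuel-↭ (length σ) σ))) unique-σ
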